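{- Let $\mathbf{x}\in\mathbf{PBad}$. Then for any matrix $A\in\mathrm{GL}_2(\mathbb{Z})$ the point $A\mathbf{x}$ is in $\mathbf{PBad}$.
   Context: $p$ is a prime and $|\cdot|_p$ the $p$-adic absolute value. Points of $\mathbf{P}^1(\mathbb{Q}_p)$ are column vectors $(q_1,q_2)^T$ in homogeneous coordinates. For $\epsilon>0$, $(q_1,q_2)\in\mathbf{PBad}_\epsilon$ if for all $(a,b)\in\mathbb{Z}^2\setminus\{(0,0)\}$, $\frac{|aq_1+bq_2|_p}{\max\{|q_1|_p,|q_2|_p\}}\ge\frac{\epsilon}{\max\{a^2,b^2\}}$; $\mathbf{PBad}=\bigcup_{\epsilon>0}\mathbf{PBad}_\epsilon$. -}

module Defs where

open import Data.Nat as ℕ using (ℕ; suc; _⊔_)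
open import Data.Integer as ℤ using (ℤ; +_; _+_; _-_; _*_; ∣_∣)
open import Data.Integer.Divisibility.Signed
  using (_∣_; ∣m∣n⇒∣m+n; ∣n⇒∣m*n)
open import Data.Integer.Tactic.RingSolver using (solve-∀)
open import Data.Rational as ℚ using (ℚ; Positive)
open import Data.Fin using (Fin; zero; suc)
open import Data.Product using (Σ; ∃; _×_; _,_; proj₁; proj₂)
open import Data.Sum using (_⊎_)
open import Relation.Nullary using (¬_)
open import Relation.Binary.PropositionalEquality using (_≡_; subst; sym)

-- p-adic integers as the inverse limit  ℤ_p = lim ℤ / p^n.  The represented p-adic integer ξ
-- satisfies ξ ≡ seq n (mod p^n) for all n.

record ℤₚ (p : ℕ) : Set where
  constructor mkℤₚ
  field
    seq : ℕ → ℤ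
    coh : ∀ n → + (p ℕ.^ n) ∣ (seq (suc n) - seq n)

open ℤₚ public

Divₚ : {p : ℕ} → ℕ → ℤₚ p → Set
Divₚ {p} j x = + (p ℕ.^ j) ∣ seq x j

IsZeroₚ : {p : ℕ} → ℤₚ p → Set
IsZeroₚ x = ∀ n → Divₚ n x

HasVal : {p : ℕ} → ℤₚ p → ℕ → Set
HasVal x j = Divₚ j x × ¬ Divₚ (suc j) x

private
  lin-lemma : ∀ a b x' x y' y →
    a * x' + b * y' - (a * x + b * y) ≡ a * (x' - x) + b * (y' - y)
  lin-lemma = solve-∀

lin : {p : ℕ} → ℤ → ℤ → ℤₚ p → ℤₚ p → ℤₚ p
lin {p} a b x y = mkℤₚ s c
  where
  s : ℕ → ℤ
  s n = a * seq x n + b * seq y n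
  c : ∀ n → + (p ℕ.^ n) ∣ (s (suc n) - s n)
  c n = subst (+ (p ℕ.^ n) ∣_)
          (sym (lin-lemma a b (seq x (suc n)) (seq x n) (seq y (suc n)) (seq y n)))
          (∣m∣n⇒∣m+n (∣n⇒∣m*n a (coh x n)) (∣n⇒∣m*n b (coh y n)))

-- Every point of P¹(ℚ_p) has homogeneous
-- coordinates in ℤ_p² (clear denominators); the defining quantity of
-- PBad is homogeneous of degree 0, so we work with such representatives.

Pair : ℕ → Set
Pair p = ℤₚ p × ℤₚ p

NonZeroPair : {p : ℕ} → Pair p → Set
NonZeroPair (q₁ , q₂) = ¬ (IsZeroₚ q₁ × IsZeroₚ q₂)

MaxAbsIs : {p : ℕ} → Pair p → ℕ → Set
MaxAbsIs (q₁ , q₂) j =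
  Divₚ j q₁ × Divₚ j q₂ × ¬ (Divₚ (suc j) q₁ × Divₚ (suc j) q₂)

ℕ→ℚ : ℕ → ℚ
ℕ→ℚ n = + n ℚ./ 1

-- (q₁,q₂) ∈ PBad_ε :  for all (a,b) ≠ (0,0),
--   |a q₁ + b q₂|_p / max{|q₁|_p,|q₂|_p}  ≥  ε / max{a²,b²}.
-- Writing max{|q₁|,|q₂|} = p^{-j} and |a q₁ + b q₂|_p = p^{-k}, this is
--   p^{j-k} ≥ ε / M   ⇔   ε · p^k ≤ M · p^j     (M = max{a²,b²});
-- if a q₁ + b q₂ = 0 (no such k) the inequality fails since ε > 0.
PBadε : (p : ℕ) → ℚ → Pair p → Set
PBadε p ε q =
  (a b : ℤ) → ¬ (a ≡ + 0 × b ≡ + 0) →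
  ∀ j → MaxAbsIs q j →
  ∃ λ k → HasVal (lin a b (proj₁ q) (proj₂ q)) k ×
          (ε ℚ.* ℕ→ℚ (p ℕ.^ k)
             ℚ.≤ ℕ→ℚ (((∣ a ∣ ℕ.* ∣ a ∣) ⊔ (∣ b ∣ ℕ.* ∣ b ∣)) ℕ.* p ℕ.^ j))

-- PBad = ⋃_{ε > 0} PBad_ε   (ε ranging over positive rationals, which
-- gives the same union as over positive reals).
PBad : (p : ℕ) → Pair p → Set
PBad p q = ∃ λ ε → Positive ε × PBadε p ε q

Mat₂ : Set
Mat₂ = Fin 2 → Fin 2 → ℤ

det : Mat₂ → ℤ
det A = A zero zero * A (suc zero) (suc zero) - A zero (suc zero) * A (suc zero) zero

InGL₂ℤ : Mat₂ → Set
InGL₂ℤ A = det A ≡ + 1 ⊎ det A ≡ ℤ.- + 1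

act : {p : ℕ} → Mat₂ → Pair p → Pair p
act A (q₁ , q₂) =
  lin (A zero zero) (A zero (suc zero)) q₁ q₂ ,
  lin (A (suc zero) zero) (A (suc zero) (suc zero)) q₁ q₂

module Submission where

open import Defs
open import Data.Nat as ℕ using (ℕ; suc; _⊔_)
import Data.Nat.Properties as ℕP
import Data.Nat.Coprimality as Coprimality
open import Data.Nat.Primality using (Prime)
open import Data.Integer as ℤ using (ℤ; +_; _+_; _-_; _*_; ∣_∣)
import Data.Integer.Properties as ℤP
open import Data.Integer.Divisibility.Signed
  using (_∣_; ∣m∣n⇒∣m+n; ∣m∣n⇒∣m-n; ∣n⇒∣m*n)
open import Data.Integer.Tactic.RingSolver using (solve-∀)
open import Data.Rational as ℚ using (ℚ; Positive)
import Data.Rational.Properties as ℚP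
open import Data.Rational.Solver using (module +-*-Solver)
open import Data.Fin using (zero; suc)
open import Data.Product using (_×_; _,_; proj₁; proj₂)
open import Data.Sum using (inj₁; inj₂)
open import Relation.Nullary using (¬_)
open import Relation.Binary.PropositionalEquality

-- If (r₁, r₂) = A (q₁, q₂), then a r₁ + b r₂ = a′ q₁ + b′ q₂ with
-- (a′, b′) = (a, b) A.  As det A = ±1, Cramer's rule shows that A and A⁻¹
-- preserve p-adic divisibility of pairs, so max{|r₁|,|r₂|} = max{|q₁|,|q₂|},
-- and (a′, b′) ≠ 0 whenever (a, b) ≠ 0.  Since max{a′², b′²} ≤ C max{a², b²}
-- with C depending only on A, the point A x lies in PBad_{ε/C} when x ∈ PBad_ε.

-- ℕ→ℚ normalises through a gcd and so does not compute on open terms;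
-- this equal form is a constructor application.
ℕ→ℚ′ : ℕ → ℚ
ℕ→ℚ′ n = ℚ.mkℚ (+ n) 0 (Coprimality.sym (Coprimality.1-coprimeTo n))

ℕ→ℚ≡ℕ→ℚ′ : ∀ n → ℕ→ℚ n ≡ ℕ→ℚ′ n
ℕ→ℚ≡ℕ→ℚ′ n = ℚP.normalize-coprime (Coprimality.sym (Coprimality.1-coprimeTo n))

ℕ→ℚ-homo-* : ∀ m n → ℕ→ℚ (m ℕ.* n) ≡ ℕ→ℚ′ m ℚ.* ℕ→ℚ n
ℕ→ℚ-homo-* m n rewrite ℕ→ℚ≡ℕ→ℚ′ n = cong (ℚ._/ 1) (ℤP.pos-* m n)

ℕ→ℚ-mono-≤ : ∀ {m n} → m ℕ.≤ n → ℕ→ℚ m ℚ.≤ ℕ→ℚ n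
ℕ→ℚ-mono-≤ {m} {n} m≤n rewrite ℕ→ℚ≡ℕ→ℚ′ m | ℕ→ℚ≡ℕ→ℚ′ n =
  ℚ.*≤* (ℤP.*-monoʳ-≤-nonNeg (+ 1) (ℤ.+≤+ m≤n))

*-1/-cancel-≤ : ∀ c .{{_ : Positive c}} {ε x y} →
  ε ℚ.* x ℚ.≤ c ℚ.* y → (ε ℚ.* (ℚ.1/ c) {{ℚP.pos⇒nonZero c}}) ℚ.* x ℚ.≤ y
*-1/-cancel-≤ c {ε} {x} {y} εx≤cy =
  ℚP.*-cancelˡ-≤-pos c (subst (ℚ._≤ c ℚ.* y) (sym c[εc⁻¹x]≡εx) εx≤cy)
  where
  instance
    _ = ℚP.pos⇒nonZero c
  open ≡-Reasoning
  open +-*-Solver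
  c[εc⁻¹x]≡εx : c ℚ.* ((ε ℚ.* ℚ.1/ c) ℚ.* x) ≡ ε ℚ.* x
  c[εc⁻¹x]≡εx = begin
    c ℚ.* ((ε ℚ.* ℚ.1/ c) ℚ.* x)
      ≡⟨ solve 4 (λ c i e x → c :* ((e :* i) :* x) := (c :* i) :* (e :* x))
               refl c (ℚ.1/ c) ε x ⟩
    (c ℚ.* ℚ.1/ c) ℚ.* (ε ℚ.* x) ≡⟨ cong (ℚ._* (ε ℚ.* x)) (ℚP.*-inverseʳ c) ⟩
    ℚ.1ℚ ℚ.* (ε ℚ.* x)            ≡⟨ ℚP.*-identityˡ (ε ℚ.* x) ⟩
    ε ℚ.* x                       ∎

unit-involutive : ∀ u → u * u ≡ + 1 → ∀ x → u * (u * x) ≡ x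
unit-involutive u u²≡1 x = begin
  u * (u * x) ≡⟨ ℤP.*-assoc u u x ⟨
  u * u * x   ≡⟨ cong (_* x) u²≡1 ⟩
  + 1 * x     ≡⟨ ℤP.*-identityˡ x ⟩
  x           ∎
  where open ≡-Reasoning

∣-unit-cancel : ∀ {m} u {x} → u * u ≡ + 1 → m ∣ u * x → m ∣ x
∣-unit-cancel {m} u {x} u²≡1 m∣ux =
  subst (m ∣_) (unit-involutive u u²≡1 x) (∣n⇒∣m*n u m∣ux)

unit-*-≡0 : ∀ u {x} → u * u ≡ + 1 → u * x ≡ + 0 → x ≡ + 0
unit-*-≡0 u {x} u²≡1 ux≡0 = begin
  x           ≡⟨ unit-involutive u u²≡1 x ⟨
  u * (u * x) ≡⟨ cong (u *_) ux≡0 ⟩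
  u * + 0     ≡⟨ ℤP.*-zeroʳ u ⟩
  + 0         ∎
  where open ≡-Reasoning

∣-lin : ∀ {m x y} a b → m ∣ x → m ∣ y → m ∣ a * x + b * y
∣-lin a b m∣x m∣y = ∣m∣n⇒∣m+n (∣n⇒∣m*n a m∣x) (∣n⇒∣m*n b m∣y)

∣-cramer : ∀ {m} a b c d {x y} → (a * d - b * c) * (a * d - b * c) ≡ + 1 →
  m ∣ a * x + b * y → m ∣ c * x + d * y → (m ∣ x) × (m ∣ y)
∣-cramer {m} a b c d {x} {y} Δ²≡1 m∣r₁ m∣r₂ =
  ∣-unit-cancel (a * d - b * c) Δ²≡1
    (subst (m ∣_) (cramer₁ a b c d x y) (∣m∣n⇒∣m-n (∣n⇒∣m*n d m∣r₁) (∣n⇒∣m*n b m∣r₂))) ,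
  ∣-unit-cancel (a * d - b * c) Δ²≡1
    (subst (m ∣_) (cramer₂ a b c d x y) (∣m∣n⇒∣m-n (∣n⇒∣m*n a m∣r₂) (∣n⇒∣m*n c m∣r₁)))
  where
  cramer₁ : ∀ a b c d x y → d * (a * x + b * y) - b * (c * x + d * y) ≡ (a * d - b * c) * x
  cramer₁ = solve-∀
  cramer₂ : ∀ a b c d x y → a * (c * x + d * y) - c * (a * x + b * y) ≡ (a * d - b * c) * y
  cramer₂ = solve-∀

row-cramer-≡0 : ∀ a b c d {x y} → (a * d - b * c) * (a * d - b * c) ≡ + 1 →
  x * a + y * c ≡ + 0 → x * b + y * d ≡ + 0 → x ≡ + 0 × y ≡ + 0
row-cramer-≡0 a b c d {x} {y} Δ²≡1 s≡0 t≡0 =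
  unit-*-≡0 (a * d - b * c) Δ²≡1
    (trans (sym (cramer₁ a b c d x y)) (cong₂ (λ s t → s * d - t * c) s≡0 t≡0)) ,
  unit-*-≡0 (a * d - b * c) Δ²≡1
    (trans (sym (cramer₂ a b c d x y)) (cong₂ (λ s t → t * a - s * b) s≡0 t≡0))
  where
  cramer₁ : ∀ a b c d x y → (x * a + y * c) * d - (x * b + y * d) * c ≡ (a * d - b * c) * x
  cramer₁ = solve-∀
  cramer₂ : ∀ a b c d x y → (x * b + y * d) * a - (x * a + y * c) * b ≡ (a * d - b * c) * y
  cramer₂ = solve-∀

∣lin∣≤ : ∀ u v x y → ∣ u * x + v * y ∣ ℕ.≤ (∣ u ∣ ⊔ ∣ v ∣) ℕ.* (∣ x ∣ ℕ.+ ∣ y ∣)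
∣lin∣≤ u v x y = begin
  ∣ u * x + v * y ∣                   ≤⟨ ℤP.∣i+j∣≤∣i∣+∣j∣ (u * x) (v * y) ⟩
  ∣ u * x ∣ ℕ.+ ∣ v * y ∣             ≡⟨ cong₂ ℕ._+_ (ℤP.∣i*j∣≡∣i∣*∣j∣ u x) (ℤP.∣i*j∣≡∣i∣*∣j∣ v y) ⟩
  ∣ u ∣ ℕ.* ∣ x ∣ ℕ.+ ∣ v ∣ ℕ.* ∣ y ∣ ≤⟨ ℕP.+-mono-≤ (ℕP.*-monoˡ-≤ ∣ x ∣ (ℕP.m≤m⊔n ∣ u ∣ ∣ v ∣))
                                                    (ℕP.*-monoˡ-≤ ∣ y ∣ (ℕP.m≤n⊔m ∣ u ∣ ∣ v ∣)) ⟩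
  m ℕ.* ∣ x ∣ ℕ.+ m ℕ.* ∣ y ∣         ≡⟨ ℕP.*-distribˡ-+ m ∣ x ∣ ∣ y ∣ ⟨
  m ℕ.* (∣ x ∣ ℕ.+ ∣ y ∣)             ∎
  where
  open ℕP.≤-Reasoning
  m = ∣ u ∣ ⊔ ∣ v ∣

sqMax : ℤ → ℤ → ℕ
sqMax a b = (∣ a ∣ ℕ.* ∣ a ∣) ⊔ (∣ b ∣ ℕ.* ∣ b ∣)

sqMax≡max² : ∀ a b → sqMax a b ≡ (∣ a ∣ ⊔ ∣ b ∣) ℕ.* (∣ a ∣ ⊔ ∣ b ∣)
sqMax≡max² a b = sym (ℕP.mono-≤-distrib-⊔ (λ m≤n → ℕP.*-mono-≤ m≤n m≤n) ∣ a ∣ ∣ b ∣)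

square-≤ : ∀ {z m n} → z ℕ.≤ m ℕ.* n → z ℕ.* z ℕ.≤ (n ℕ.* n) ℕ.* (m ℕ.* m)
square-≤ {z} {m} {n} z≤mn = begin
  z ℕ.* z                 ≤⟨ ℕP.*-mono-≤ z≤mn z≤mn ⟩
  (m ℕ.* n) ℕ.* (m ℕ.* n) ≡⟨ ℕP.[m*n]*[o*p]≡[m*o]*[n*p] m n m n ⟩
  (m ℕ.* m) ℕ.* (n ℕ.* n) ≡⟨ ℕP.*-comm (m ℕ.* m) (n ℕ.* n) ⟩
  (n ℕ.* n) ℕ.* (m ℕ.* m) ∎
  where open ℕP.≤-Reasoning

infixl 7 _·_

_·_ : ℤ × ℤ → Mat₂ → ℤ × ℤ
(a , b) · A =
  a * A zero zero + b * A (suc zero) zero ,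
  a * A zero (suc zero) + b * A (suc zero) (suc zero)

‖_‖ : Mat₂ → ℕ
‖ A ‖ = (∣ A zero zero ∣ ℕ.+ ∣ A (suc zero) zero ∣)
      ℕ.+ (∣ A zero (suc zero) ∣ ℕ.+ ∣ A (suc zero) (suc zero) ∣)

sqMax-·-≤ : ∀ a b A →
  sqMax (proj₁ ((a , b) · A)) (proj₂ ((a , b) · A)) ℕ.≤ (‖ A ‖ ℕ.* ‖ A ‖) ℕ.* sqMax a b
sqMax-·-≤ a b A rewrite sqMax≡max² a b = ℕP.⊔-lub
  (square-≤ {m = m} {‖ A ‖} (ℕP.≤-trans (∣lin∣≤ a b _ _) (ℕP.*-monoʳ-≤ m (ℕP.m≤m+n col₁ col₂))))
  (square-≤ {m = m} {‖ A ‖} (ℕP.≤-trans (∣lin∣≤ a b _ _) (ℕP.*-monoʳ-≤ m (ℕP.m≤n+m col₂ col₁))))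
  where
  m = ∣ a ∣ ⊔ ∣ b ∣
  col₁ = ∣ A zero zero ∣ ℕ.+ ∣ A (suc zero) zero ∣
  col₂ = ∣ A zero (suc zero) ∣ ℕ.+ ∣ A (suc zero) (suc zero) ∣

-- The summand 1 keeps the constant nonzero without having to exclude A = 0.
distortion : Mat₂ → ℕ
distortion A = suc (‖ A ‖ ℕ.* ‖ A ‖)

det²≡1 : ∀ {A} → InGL₂ℤ A → det A * det A ≡ + 1
det²≡1 (inj₁ Δ≡1)  rewrite Δ≡1  = refl
det²≡1 (inj₂ Δ≡-1) rewrite Δ≡-1 = refl

lin-act : ∀ {p} a b A (x : Pair p) n →
  seq (lin a b (proj₁ (act A x)) (proj₂ (act A x))) n
    ≡ seq (lin (proj₁ ((a , b) · A)) (proj₂ ((a , b) · A)) (proj₁ x) (proj₂ x)) n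
lin-act a b A x n = lin-lin a b (A zero zero) (A zero (suc zero))
  (A (suc zero) zero) (A (suc zero) (suc zero)) (seq (proj₁ x) n) (seq (proj₂ x) n)
  where
  lin-lin : ∀ a b a₀₀ a₀₁ a₁₀ a₁₁ x y →
    a * (a₀₀ * x + a₀₁ * y) + b * (a₁₀ * x + a₁₁ * y)
      ≡ (a * a₀₀ + b * a₁₀) * x + (a * a₀₁ + b * a₁₁) * y
  lin-lin = solve-∀

module _ {p : ℕ} (A : Mat₂) (A∈GL : InGL₂ℤ A) where

  Divₚ-act⁻¹ : ∀ {x : Pair p} j → Divₚ j (proj₁ (act A x)) → Divₚ j (proj₂ (act A x)) →
    Divₚ j (proj₁ x) × Divₚ j (proj₂ x)
  Divₚ-act⁻¹ j = ∣-cramer (A zero zero) (A zero (suc zero))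
    (A (suc zero) zero) (A (suc zero) (suc zero)) (det²≡1 {A} A∈GL)

  NonZeroPair-act : ∀ {x : Pair p} → NonZeroPair x → NonZeroPair (act A x)
  NonZeroPair-act {x} x≢0 (Ax₁≡0 , Ax₂≡0) = x≢0
    ( (λ n → proj₁ (Divₚ-act⁻¹ {x} n (Ax₁≡0 n) (Ax₂≡0 n)))
    , (λ n → proj₂ (Divₚ-act⁻¹ {x} n (Ax₁≡0 n) (Ax₂≡0 n))))

  MaxAbsIs-act⁻¹ : ∀ {x : Pair p} {j} → MaxAbsIs (act A x) j → MaxAbsIs x j
  MaxAbsIs-act⁻¹ {x} {j} (pʲ∣Ax₁ , pʲ∣Ax₂ , pʲ⁺¹∤Ax) =
    proj₁ pʲ∣x , proj₂ pʲ∣x ,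
    λ (pʲ⁺¹∣x₁ , pʲ⁺¹∣x₂) → pʲ⁺¹∤Ax
      (∣-lin (A zero zero) (A zero (suc zero)) pʲ⁺¹∣x₁ pʲ⁺¹∣x₂ ,
       ∣-lin (A (suc zero) zero) (A (suc zero) (suc zero)) pʲ⁺¹∣x₁ pʲ⁺¹∣x₂)
    where pʲ∣x = Divₚ-act⁻¹ {x} j pʲ∣Ax₁ pʲ∣Ax₂

  ·-nonZero : ∀ {a b} → ¬ (a ≡ + 0 × b ≡ + 0) →
    ¬ (proj₁ ((a , b) · A) ≡ + 0 × proj₂ ((a , b) · A) ≡ + 0)
  ·-nonZero ab≢0 (a′≡0 , b′≡0) = ab≢0 (row-cramer-≡0 (A zero zero) (A zero (suc zero))
    (A (suc zero) zero) (A (suc zero) (suc zero)) (det²≡1 {A} A∈GL) a′≡0 b′≡0)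

  sqMax-·-≤-distortion : ∀ a b j →
    sqMax (proj₁ ((a , b) · A)) (proj₂ ((a , b) · A)) ℕ.* p ℕ.^ j
      ℕ.≤ distortion A ℕ.* (sqMax a b ℕ.* p ℕ.^ j)
  sqMax-·-≤-distortion a b j = begin
    sqMax (proj₁ ((a , b) · A)) (proj₂ ((a , b) · A)) ℕ.* p ℕ.^ j
      ≤⟨ ℕP.*-monoˡ-≤ (p ℕ.^ j) (ℕP.≤-trans (sqMax-·-≤ a b A)
           (ℕP.*-monoˡ-≤ (sqMax a b) (ℕP.n≤1+n (‖ A ‖ ℕ.* ‖ A ‖)))) ⟩
    distortion A ℕ.* sqMax a b ℕ.* p ℕ.^ j   ≡⟨ ℕP.*-assoc (distortion A) (sqMax a b) (p ℕ.^ j) ⟩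
    distortion A ℕ.* (sqMax a b ℕ.* p ℕ.^ j) ∎
    where open ℕP.≤-Reasoning

  HasVal-lin-act : ∀ a b (x : Pair p) {k} →
    let a′ , b′ = (a , b) · A in
    HasVal (lin a′ b′ (proj₁ x) (proj₂ x)) k →
    HasVal (lin a b (proj₁ (act A x)) (proj₂ (act A x))) k
  HasVal-lin-act a b x {k} (pᵏ∣ , pᵏ⁺¹∤) =
    subst (_ ∣_) (sym (lin-act a b A x k)) pᵏ∣ ,
    λ pᵏ⁺¹∣ → pᵏ⁺¹∤ (subst (_ ∣_) (lin-act a b A x (suc k)) pᵏ⁺¹∣)

  ℕ→ℚ-sqMax-·-≤ : ∀ a b j →
    ℕ→ℚ (sqMax (proj₁ ((a , b) · A)) (proj₂ ((a , b) · A)) ℕ.* p ℕ.^ j)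
      ℚ.≤ ℕ→ℚ′ (distortion A) ℚ.* ℕ→ℚ (sqMax a b ℕ.* p ℕ.^ j)
  ℕ→ℚ-sqMax-·-≤ a b j = ℚP.≤-trans (ℕ→ℚ-mono-≤ (sqMax-·-≤-distortion a b j))
    (ℚP.≤-reflexive (ℕ→ℚ-homo-* (distortion A) (sqMax a b ℕ.* p ℕ.^ j)))

  PBadε-act : ∀ {ε} {x : Pair p} → PBadε p ε x →
    PBadε p (ε ℚ.* ℚ.1/ ℕ→ℚ′ (distortion A)) (act A x)
  PBadε-act {ε} {x} x∈Bad a b ab≢0 j |Ax|=pʲ =
    let a′ , b′ = (a , b) · A
        k , v[a′x₁+b′x₂]=k , εpᵏ≤M′pʲ =
          x∈Bad a′ b′ (·-nonZero ab≢0) j (MaxAbsIs-act⁻¹ {x} |Ax|=pʲ)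
    in k , HasVal-lin-act a b x v[a′x₁+b′x₂]=k ,
       *-1/-cancel-≤ (ℕ→ℚ′ (distortion A)) {ε = ε}
         (ℚP.≤-trans εpᵏ≤M′pʲ (ℕ→ℚ-sqMax-·-≤ a b j))

lemma6 : (p : ℕ) → Prime p → (x : Pair p) → NonZeroPair x → PBad p x →
         (A : Mat₂) → InGL₂ℤ A →
         NonZeroPair (act A x) × PBad p (act A x)
lemma6 p _ x x≢0 (ε , ε>0 , x∈Badε) A A∈GL =
  NonZeroPair-act A A∈GL {x} x≢0 ,
  (ε ℚ.* ℚ.1/ ℕ→ℚ′ (distortion A) ,
   ℚP.pos*pos⇒pos ε {{ε>0}} _ {{ℚP.1/pos⇒pos (ℕ→ℚ′ (distortion A))}} ,
   PBadε-act A A∈GL {ε} {x} x∈Badε)
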